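{- Let $t,p,q,k$ be positive integers with $2t \leq p \leq t^2$, $q>0$ and $k \geq p+q$. Then $C_{p,q}$ is a submatrix of $A_{k,t}$.
   Context: For positive integers $k,t$ with $k\ge t$, $A_{k,t}$ is the $0,1$-matrix of size $\binom{k}{t}\times\binom{k}{t}$ whose rows and columns are indexed by all $t$-element subsets of $[k]=\{1,\dots,k\}$, with entry $1$ in row $x$, column $y$ if and only if $x\cap y\neq\emptyset$. For integers $p\ge 1$, $q\ge 0$ and $n=p+q$, $C_{p,q}$ is the $n\times n$ circulant $0,1$-matrix whose entry in row $i$, column $j$ ($1\le i,j\le n$) is $1$ iff $(i-j) \bmod n \in\{0,1,\dots,p-1\}$. An $n\times m$ $0,1$-matrix $M$ is a submatrix of $A_{k,t}$ if there are distinct $t$-subsets $F_1,\dots,F_n$ of $[k]$ and distinct $t$-subsets $G_1,\dots,G_m$ of $[k]$ with $M_{ij}=1$ iff $F_i\cap G_j\ne\emptyset$. -}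

module Defs where

open import Data.Nat using (ℕ; suc; _+_; _∸_; _<_; NonZero)
open import Data.Nat.DivMod using (_%_)
open import Data.Fin using (Fin; toℕ)
open import Data.Fin.Subset using (Subset; ∣_∣; _∩_; Nonempty)
open import Data.Product using (Σ; _×_)
open import Function.Definitions using (Injective)
open import Function.Bundles using (_⇔_)
open import Relation.Binary.PropositionalEquality using (_≡_)

-- A 0,1-matrix of size n × m, entries given as propositions
-- (entry is 1 iff the proposition holds).
Matrix01 : ℕ → ℕ → Set₁
Matrix01 n m = Fin n → Fin m → Set

-- Here n = p + q with p ≥ 1, written as suc p' + q to make n nonzero;
-- we define it for general p, using (n + i ∸ j) % n for (i - j) mod n.
C : (p q : ℕ) → .{{NonZero (p + q)}} → Matrix01 (p + q) (p + q)
C p q i j = ((p + q + toℕ i ∸ toℕ j) % (p + q)) < p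

-- M is a submatrix of A_{k,t}: distinct t-subsets F_1..F_n and distinct
-- t-subsets G_1..G_m of [k] with M i j iff F_i ∩ G_j ≠ ∅.
IsSubmatrixOfA : (k t : ℕ) {n m : ℕ} → Matrix01 n m → Set
IsSubmatrixOfA k t {n} {m} M =
  Σ (Fin n → Subset k) λ F →
  Σ (Fin m → Subset k) λ G →
    Injective _≡_ _≡_ F × Injective _≡_ _≡_ G ×
    (∀ i → ∣ F i ∣ ≡ t) × (∀ j → ∣ G j ∣ ≡ t) ×
    (∀ i j → M i j ⇔ Nonempty (F i ∩ G j))

module Submission where

-- Write p = t + u + t.  Points of [k] are taken to be residues modulo n.  Row i
-- of C_{p,q} becomes the t-set F i = {i − a | a < t} and column j becomes the
-- t-set G j = {j + offset m | m < t}, where 0 = offset 0 < … < offset (t − 1)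
-- = t + u is a staircase with steps of size at most t (this needs p ≤ t²).
-- Then F i meets G j iff i − j ≡ offset m + a (mod n) for some m, a < t, and
-- the sums offset m + a fill out exactly [0, p): this is the entry (i, j) of
-- C_{p,q}.  Distinctness of the sets follows because the rows (and columns) of
-- a circulant with window 0 < p < n are pairwise distinct.

open import Defs
open import Data.Nat
open import Data.Nat.Properties
open import Data.Nat.DivMod
open import Data.Nat.Tactic.RingSolver using (solve-∀)
open import Data.Fin using (Fin; zero; suc; toℕ; fromℕ<)
open import Data.Fin.Properties using (toℕ-fromℕ<; toℕ-injective; toℕ<n; fromℕ<-cong; fromℕ<-injective)
  renaming (suc-injective to Fin-suc-injective)
open import Data.Fin.Subset using (Subset; ⊥; ⁅_⁆; _∪_; _∩_; _∈_; _∉_; ∣_∣; Nonempty; inside; outside)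
open import Data.Fin.Subset.Properties
  using (x∈p∪q⁻; x∈p∪q⁺; x∈⁅y⁆⇒x≡y; x∈⁅x⁆; ∉⊥; ∣⊥∣≡0; ∪-identityˡ; x∈p∩q⁺; x∈p∩q⁻)
open import Data.Vec using (_∷_; here; there)
open import Data.Product using (∃; ∃₂; _×_; _,_)
open import Data.Sum using (inj₁; inj₂)
open import Function using (_∘_; _⇔_; mk⇔; Equivalence)
open import Function.Properties.Equivalence using () renaming (sym to ⇔-sym; trans to ⇔-trans)
open import Function.Definitions using (Injective)
open import Relation.Binary.PropositionalEquality
open import Relation.Binary.Definitions using (tri<; tri≈; tri>)
open import Relation.Nullary using (¬_; yes; no; contradiction)

image : ∀ {t k} → (Fin t → Fin k) → Subset k
image {zero}  f = ⊥
image {suc t} f = ⁅ f zero ⁆ ∪ image (f ∘ suc)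

∈-image⁺ : ∀ {t k} (f : Fin t → Fin k) a → f a ∈ image f
∈-image⁺ f zero    = x∈p∪q⁺ (inj₁ (x∈⁅x⁆ (f zero)))
∈-image⁺ f (suc a) = x∈p∪q⁺ (inj₂ (∈-image⁺ (f ∘ suc) a))

∈-image⁻ : ∀ {t k} (f : Fin t → Fin k) {x} → x ∈ image f → ∃ λ a → f a ≡ x
∈-image⁻ {zero}  f x∈ = contradiction x∈ ∉⊥
∈-image⁻ {suc t} f x∈ with x∈p∪q⁻ ⁅ f zero ⁆ (image (f ∘ suc)) x∈
... | inj₁ x∈⁅f0⁆ = zero , sym (x∈⁅y⁆⇒x≡y (f zero) x∈⁅f0⁆)
... | inj₂ x∈rest with ∈-image⁻ (f ∘ suc) x∈rest
...   | a , fa≡x = suc a , fa≡x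

∣⁅x⁆∪p∣≡1+∣p∣ : ∀ {k} (x : Fin k) (p : Subset k) → x ∉ p → ∣ ⁅ x ⁆ ∪ p ∣ ≡ suc ∣ p ∣
∣⁅x⁆∪p∣≡1+∣p∣ zero    (inside  ∷ p) x∉ = contradiction here x∉
∣⁅x⁆∪p∣≡1+∣p∣ zero    (outside ∷ p) x∉ = cong (suc ∘ ∣_∣) (∪-identityˡ p)
∣⁅x⁆∪p∣≡1+∣p∣ (suc x) (inside  ∷ p) x∉ = cong suc (∣⁅x⁆∪p∣≡1+∣p∣ x p (x∉ ∘ there))
∣⁅x⁆∪p∣≡1+∣p∣ (suc x) (outside ∷ p) x∉ = ∣⁅x⁆∪p∣≡1+∣p∣ x p (x∉ ∘ there)

∣image∣ : ∀ {t k} (f : Fin t → Fin k) → Injective _≡_ _≡_ f → ∣ image f ∣ ≡ t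
∣image∣ {zero}  {k} f f-inj = ∣⊥∣≡0 k
∣image∣ {suc t}     f f-inj =
  trans (∣⁅x⁆∪p∣≡1+∣p∣ (f zero) (image (f ∘ suc)) f0∉rest)
        (cong suc (∣image∣ (f ∘ suc) (Fin-suc-injective ∘ f-inj)))
  where
  f0∉rest : f zero ∉ image (f ∘ suc)
  f0∉rest f0∈ with ∈-image⁻ (f ∘ suc) f0∈
  ... | a , fsa≡f0 with f-inj fsa≡f0
  ...   | ()

image-meet : ∀ {s t k} (f : Fin s → Fin k) (g : Fin t → Fin k) →
             Nonempty (image f ∩ image g) ⇔ ∃₂ λ a b → f a ≡ g b
image-meet f g = mk⇔ meet⇒ meet⇐
  where
  meet⇒ : Nonempty (image f ∩ image g) → ∃₂ λ a b → f a ≡ g b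
  meet⇒ (x , x∈f∩g) with x∈p∩q⁻ (image f) (image g) x∈f∩g
  ... | x∈f , x∈g with ∈-image⁻ f x∈f | ∈-image⁻ g x∈g
  ...   | a , fa≡x | b , gb≡x = a , b , trans fa≡x (sym gb≡x)
  meet⇐ : (∃₂ λ a b → f a ≡ g b) → Nonempty (image f ∩ image g)
  meet⇐ (a , b , fa≡gb) =
    g b , x∈p∩q⁺ (subst (_∈ image f) fa≡gb (∈-image⁺ f a) , ∈-image⁺ g b)

module Residues (n : ℕ) .{{_ : NonZero n}} where

  infix 4 _≈_
  _≈_ : ℕ → ℕ → Set
  x ≈ y = x % n ≡ y % n

  %-≈ : ∀ x → x % n ≈ x
  %-≈ x = m%n%n≡m%n x n

  +n-≈ : ∀ x → x + n ≈ x
  +n-≈ x = [m+n]%n≡m%n x n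

  ≈-+ : ∀ {x x' y y'} → x ≈ x' → y ≈ y' → x + y ≈ x' + y'
  ≈-+ {x} {x'} {y} {y'} x≈x' y≈y' = begin
    (x + y) % n            ≡⟨ %-distribˡ-+ x y n ⟩
    (x % n + y % n) % n    ≡⟨ cong₂ (λ a b → (a + b) % n) x≈x' y≈y' ⟩
    (x' % n + y' % n) % n  ≡⟨ %-distribˡ-+ x' y' n ⟨
    (x' + y') % n          ∎
    where open ≡-Reasoning

  -- Adding z and then n ∸ z % n is a full turn; this undoes a shift by z.
  ≈-unshift : ∀ x z → x ≈ x + z + (n ∸ z % n)
  ≈-unshift x z = begin
    x % n                          ≡⟨ +n-≈ x ⟨
    (x + n) % n                    ≡⟨ cong (λ m → (x + m) % n) (m+[n∸m]≡n (m%n≤n z n)) ⟨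
    (x + (z % n + (n ∸ z % n))) % n ≡⟨ ≈-+ {x} refl (≈-+ (%-≈ z) refl) ⟩
    (x + (z + (n ∸ z % n))) % n    ≡⟨ cong (_% n) (+-assoc x z _) ⟨
    (x + z + (n ∸ z % n)) % n      ∎
    where open ≡-Reasoning

  ≈-cancelʳ : ∀ {x y} z → x + z ≈ y + z → x ≈ y
  ≈-cancelʳ {x} {y} z x+z≈y+z =
    trans (≈-unshift x z) (trans (≈-+ x+z≈y+z refl) (sym (≈-unshift y z)))

  ≈-cancelˡ : ∀ {x y} z → z + x ≈ z + y → x ≈ y
  ≈-cancelˡ {x} {y} z z+x≈z+y =
    ≈-cancelʳ z (trans (cong (_% n) (+-comm x z)) (trans z+x≈z+y (cong (_% n) (+-comm z y))))

  ≈⇒≡ : ∀ {x y} → x < n → y < n → x ≈ y → x ≡ y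
  ≈⇒≡ x<n y<n x≈y = trans (sym (m<n⇒m%n≡m x<n)) (trans x≈y (m<n⇒m%n≡m y<n))

  -- The representative n + i ∸ j of i − j; its residue is the cyclic difference
  -- that defines the circulant C.
  infixl 6 _⊖_
  _⊖_ : ℕ → ℕ → ℕ
  i ⊖ j = n + i ∸ j

  ⊖-+ : ∀ {j} i → j ≤ n → i ⊖ j + j ≈ i
  ⊖-+ {j} i j≤n = begin
    (n + i ∸ j + j) % n ≡⟨ cong (_% n) (m∸n+n≡m (≤-trans j≤n (m≤m+n n i))) ⟩
    (n + i) % n         ≡⟨ cong (_% n) (+-comm n i) ⟩
    (i + n) % n         ≡⟨ +n-≈ i ⟩
    i % n               ∎
    where open ≡-Reasoning

  %⊖-+ : ∀ {j} i → j ≤ n → (i ⊖ j) % n + j ≈ i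
  %⊖-+ {j} i j≤n = trans (≈-+ (%-≈ (i ⊖ j)) refl) (⊖-+ i j≤n)

  ⊖-unique : ∀ {i j d} → j ≤ n → d < n → d + j ≈ i → (i ⊖ j) % n ≡ d
  ⊖-unique {i} {j} {d} j≤n d<n d+j≈i =
    ≈⇒≡ (m%n<n (i ⊖ j) n) d<n (≈-cancelʳ j (trans (%⊖-+ i j≤n) (sym d+j≈i)))

  ⊖-self : ∀ {i} → i ≤ n → (i ⊖ i) % n ≡ 0
  ⊖-self i≤n = ⊖-unique i≤n (>-nonZero⁻¹ n) refl

  ⊖-step : ∀ {z w z' w' e} → w ≤ n → w' ≤ n → e < n → z' + suc w ≈ z + w' →
           (z ⊖ w) % n ≡ suc e → (z' ⊖ w') % n ≡ e
  ⊖-step {z} {w} {z'} {w'} {e} w≤n w'≤n e<n shifted z⊖w≡1+e =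
    ⊖-unique w'≤n e<n (≈-cancelʳ (suc w) (begin
      (e + w' + suc w) % n ≡⟨ cong (_% n) (rearrange e w' w) ⟩
      (suc e + w + w') % n ≡⟨ ≈-+ 1+e+w≈z refl ⟩
      (z + w') % n         ≡⟨ shifted ⟨
      (z' + suc w) % n     ∎))
    where
    open ≡-Reasoning
    1+e+w≈z : suc e + w ≈ z
    1+e+w≈z = subst (λ d → d + w ≈ z) z⊖w≡1+e (%⊖-+ z w≤n)
    rearrange : ∀ a b c → a + b + suc c ≡ suc a + c + b
    rearrange = solve-∀

  window-edge : ∀ {p z w z' w'} → p ≤ n → z < n → w < n → w' ≤ n →
    (z ⊖ w) % n < p → ¬ ((z' ⊖ w') % n < p) → z' + suc w ≈ z + w' → z ≡ w
  window-edge {p} {z} {w} {z'} {w'} p≤n z<n w<n w'≤n zw∈window z'w'∉window shifted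
    with (z ⊖ w) % n in z⊖w≡d
  ... | zero  = ≈⇒≡ z<n w<n (sym (subst (λ d → d + w ≈ z) z⊖w≡d (%⊖-+ z (<⇒≤ w<n))))
  ... | suc e = contradiction e∈window z'w'∉window
    where
    e<p : e < p
    e<p = <-trans (n<1+n e) zw∈window
    e∈window : (z' ⊖ w') % n < p
    e∈window = subst (_< p) (sym (⊖-step (<⇒≤ w<n) w'≤n (<-≤-trans e<p p≤n) shifted z⊖w≡d)) e<p

  ⊖-injective : ∀ {i a a'} → a < n → a' < n → i ⊖ a ≈ i ⊖ a' → a ≡ a'
  ⊖-injective {i} {a} {a'} a<n a'<n i⊖a≈i⊖a' =
    ≈⇒≡ a<n a'<n (≈-cancelʳ d (begin
      (a + d) % n  ≡⟨ cong (_% n) (+-comm a d) ⟩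
      (d + a) % n  ≡⟨ %⊖-+ i (<⇒≤ a<n) ⟩
      i % n        ≡⟨ %⊖-+ i (<⇒≤ a'<n) ⟨
      (d' + a') % n ≡⟨ cong (λ e → (e + a') % n) i⊖a≈i⊖a' ⟨
      (d + a') % n ≡⟨ cong (_% n) (+-comm d a') ⟩
      (a' + d) % n ∎))
    where
    open ≡-Reasoning
    d d' : ℕ
    d  = (i ⊖ a) % n
    d' = (i ⊖ a') % n

  meet-iff : ∀ {i j a x} → j ≤ n → a ≤ n → x + a < n →
             i ⊖ a ≈ j + x ⇔ (i ⊖ j) % n ≡ x + a
  meet-iff {i} {j} {a} {x} j≤n a≤n x+a<n = mk⇔ to from
    where
    open ≡-Reasoning
    rearrange : ∀ x a j → x + a + j ≡ j + x + a
    rearrange = solve-∀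
    to : i ⊖ a ≈ j + x → (i ⊖ j) % n ≡ x + a
    to i⊖a≈j+x = ⊖-unique j≤n x+a<n (begin
      (x + a + j) % n   ≡⟨ cong (_% n) (rearrange x a j) ⟩
      (j + x + a) % n   ≡⟨ ≈-+ i⊖a≈j+x refl ⟨
      (i ⊖ a + a) % n   ≡⟨ ⊖-+ i a≤n ⟩
      i % n             ∎)
    from : (i ⊖ j) % n ≡ x + a → i ⊖ a ≈ j + x
    from i⊖j≡x+a = ≈-cancelʳ a (begin
      (i ⊖ a + a) % n       ≡⟨ ⊖-+ i a≤n ⟩
      i % n                 ≡⟨ %⊖-+ i j≤n ⟨
      ((i ⊖ j) % n + j) % n ≡⟨ cong (λ d → (d + j) % n) i⊖j≡x+a ⟩
      (x + a + j) % n       ≡⟨ cong (_% n) (rearrange x a j) ⟩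
      (j + x + a) % n       ∎)

  InWindow : ℕ → Fin n → Fin n → Set
  InWindow p i j = (toℕ i ⊖ toℕ j) % n < p

  diagonal∈window : ∀ {p} → 0 < p → (i : Fin n) → InWindow p i i
  diagonal∈window {p} 0<p i = subst (_< p) (sym (⊖-self (<⇒≤ (toℕ<n i)))) 0<p

  pred-n∉window : ∀ {p i j} → p < n → (toℕ i ⊖ toℕ j) % n ≡ pred n → ¬ InWindow p i j
  pred-n∉window {p} p<n i⊖j≡n-1 ij∈window =
    <⇒≱ (subst (_< p) i⊖j≡n-1 ij∈window) (<⇒≤pred p<n)

  pred-n<n : pred n < n
  pred-n<n = subst (pred n <_) (suc-pred n) ≤-refl

  next prev : Fin n → Fin n
  next i = (toℕ i + 1) mod n
  prev i = (toℕ i + pred n) mod n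

  next-≈ : ∀ i → toℕ (next i) ≈ suc (toℕ i)
  next-≈ i = trans (cong (_% n) (toℕ-fromℕ< _))
                   (trans (%-≈ (toℕ i + 1)) (cong (_% n) (+-comm (toℕ i) 1)))

  prev-≈ : ∀ i → toℕ (prev i) ≈ toℕ i + pred n
  prev-≈ i = trans (cong (_% n) (toℕ-fromℕ< _)) (%-≈ (toℕ i + pred n))

  ⊖-next : ∀ i → (toℕ i ⊖ toℕ (next i)) % n ≡ pred n
  ⊖-next i = ⊖-unique (<⇒≤ (toℕ<n (next i))) pred-n<n (begin
    (pred n + toℕ (next i)) % n ≡⟨ ≈-+ {pred n} refl (next-≈ i) ⟩
    (pred n + suc (toℕ i)) % n  ≡⟨ cong (_% n) (+-suc (pred n) (toℕ i)) ⟩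
    (suc (pred n) + toℕ i) % n  ≡⟨ cong (λ m → (m + toℕ i) % n) (suc-pred n) ⟩
    (n + toℕ i) % n             ≡⟨ cong (_% n) (+-comm n (toℕ i)) ⟩
    (toℕ i + n) % n             ≡⟨ +n-≈ (toℕ i) ⟩
    toℕ i % n                   ∎)
    where open ≡-Reasoning

  ⊖-prev : ∀ j → (toℕ (prev j) ⊖ toℕ j) % n ≡ pred n
  ⊖-prev j = ⊖-unique (<⇒≤ (toℕ<n j)) pred-n<n
    (trans (cong (_% n) (+-comm (pred n) (toℕ j))) (sym (prev-≈ j)))

  -- For 0 < p < n the rows of the circulant are pairwise distinct: row i
  -- contains column i but not column i + 1.
  row-determines : ∀ {p} → 0 < p → p < n → ∀ {i i'} →
                   (∀ j → InWindow p i j ⇔ InWindow p i' j) → i ≡ i'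
  row-determines {p} 0<p p<n {i} {i'} same-row =
    sym (toℕ-injective (window-edge (<⇒≤ p<n) (toℕ<n i') (toℕ<n i) (<⇒≤ (toℕ<n (next i)))
      i∈row-i' next-i∉row-i' (≈-+ {toℕ i'} refl (sym (next-≈ i)))))
    where
    i∈row-i' : InWindow p i' i
    i∈row-i' = Equivalence.to (same-row i) (diagonal∈window 0<p i)
    next-i∉row-i' : ¬ InWindow p i' (next i)
    next-i∉row-i' = pred-n∉window {i = i} {j = next i} p<n (⊖-next i)
                    ∘ Equivalence.from (same-row (next i))

  -- Likewise the columns: column j contains row j but not row j − 1.
  column-determines : ∀ {p} → 0 < p → p < n → ∀ {j j'} →
                      (∀ i → InWindow p i j ⇔ InWindow p i j') → j ≡ j'
  column-determines {p} 0<p p<n {j} {j'} same-column =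
    toℕ-injective (window-edge (<⇒≤ p<n) (toℕ<n j) (toℕ<n j') (<⇒≤ (toℕ<n j'))
      j∈column-j' prev-j∉column-j' shifted)
    where
    j∈column-j' : InWindow p j j'
    j∈column-j' = Equivalence.to (same-column j) (diagonal∈window 0<p j)
    prev-j∉column-j' : ¬ InWindow p (prev j) j'
    prev-j∉column-j' = pred-n∉window {i = prev j} {j = j} p<n (⊖-prev j)
                       ∘ Equivalence.from (same-column (prev j))
    rearrange : ∀ a b c → a + c + suc b ≡ a + b + suc c
    rearrange = solve-∀
    shifted : toℕ (prev j) + suc (toℕ j') ≈ toℕ j + toℕ j'
    shifted = begin
      (toℕ (prev j) + suc (toℕ j')) % n     ≡⟨ ≈-+ (prev-≈ j) refl ⟩
      (toℕ j + pred n + suc (toℕ j')) % n   ≡⟨ cong (_% n) (rearrange (toℕ j) (toℕ j') (pred n)) ⟩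
      (toℕ j + toℕ j' + suc (pred n)) % n   ≡⟨ cong (λ m → (toℕ j + toℕ j' + m) % n) (suc-pred n) ⟩
      (toℕ j + toℕ j' + n) % n              ≡⟨ +n-≈ (toℕ j + toℕ j') ⟩
      (toℕ j + toℕ j') % n                  ∎
      where open ≡-Reasoning

step-increasing⇒increasing : (f : ℕ → ℕ) → (∀ m → f m < f (suc m)) →
                             ∀ {m m'} → m < m' → f m < f m'
step-increasing⇒increasing f f-step {m} {suc m'} m<1+m' with m≤n⇒m<n∨m≡n (s≤s⁻¹ m<1+m')
... | inj₁ m<m' = <-trans (step-increasing⇒increasing f f-step m<m') (f-step m')
... | inj₂ refl = f-step m

step-increasing⇒injective : (f : ℕ → ℕ) → (∀ m → f m < f (suc m)) → Injective _≡_ _≡_ f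
step-increasing⇒injective f f-step {m} {m'} fm≡fm' with <-cmp m m'
... | tri< m<m' _ _ = contradiction fm≡fm' (<⇒≢ (step-increasing⇒increasing f f-step m<m'))
... | tri≈ _ m≡m' _ = m≡m'
... | tri> _ _ m>m' =
  contradiction fm≡fm' (≢-sym (<⇒≢ (step-increasing⇒increasing f f-step m>m')))

cover : (b : ℕ → ℕ) {t : ℕ} .{{_ : NonZero t}} → b 0 ≡ 0 → (∀ m → b (suc m) ≤ b m + t) →
        ∀ M {d} → d < b M + t → ∃₂ λ m a → m ≤ M × a < t × b m + a ≡ d
cover b b0≡0 gap zero {d} d<b0+t =
  0 , d , z≤n , subst (λ z → d < z + _) b0≡0 d<b0+t , cong (_+ d) b0≡0
cover b {t} b0≡0 gap (suc M) {d} d<bM+t with b (suc M) ≤? d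
... | yes bM≤d = suc M , d ∸ b (suc M) , ≤-refl , m<n+o⇒m∸n<o d (b (suc M)) d<bM+t , m+[n∸m]≡n bM≤d
... | no  bM≰d with cover b b0≡0 gap M (<-≤-trans (≰⇒> bM≰d) (gap M))
...   | m , a , m≤M , a<t , bm+a≡d = m , a , m≤n⇒m≤1+n m≤M , a<t , bm+a≡d

module Offsets (s u : ℕ) where

  t : ℕ
  t = suc s

  offset : ℕ → ℕ
  offset m = (m * t) ⊓ (m + suc u)

  offset-gap : ∀ m → offset (suc m) ≤ offset m + t
  offset-gap m = begin
    (t + m * t) ⊓ (suc m + suc u)      ≤⟨ ⊓-monoʳ-≤ (t + m * t) (s≤s (m≤n+m (m + suc u) s)) ⟩
    (t + m * t) ⊓ (t + (m + suc u))    ≡⟨ +-distribˡ-⊓ t (m * t) (m + suc u) ⟨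
    t + offset m                       ≡⟨ +-comm t (offset m) ⟩
    offset m + t                       ∎
    where open ≤-Reasoning

  offset-increasing : ∀ m → offset m < offset (suc m)
  offset-increasing m =
    ⊓-glb (s≤s (≤-trans (m⊓n≤m (m * t) (m + suc u)) (m≤n+m (m * t) s)))
          (s≤s (m⊓n≤n (m * t) (m + suc u)))

  offset-≤ : ∀ {m} → m ≤ s → offset m ≤ t + u
  offset-≤ {m} m≤s = ≤-trans (m⊓n≤n (m * t) (m + suc u))
                             (≤-trans (+-monoˡ-≤ (suc u) m≤s) (≤-reflexive (+-suc s u)))

  compose-< : (m a : Fin t) → offset (toℕ m) + toℕ a < t + u + t
  compose-< m a = +-mono-≤-< (offset-≤ (s≤s⁻¹ (toℕ<n m))) (toℕ<n a)

  -- When t + u ≤ s * t (that is t + u + t ≤ t²) the last offset reaches t + u.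
  offset-last : t + u ≤ s * t → t + u ≤ offset s
  offset-last t+u≤s*t = ⊓-glb t+u≤s*t (≤-reflexive (sym (+-suc s u)))

  decompose : t + u ≤ s * t → ∀ {d} → d < t + u + t →
              ∃₂ λ (m a : Fin t) → offset (toℕ m) + toℕ a ≡ d
  decompose t+u≤s*t {d} d<p
    with cover offset refl offset-gap s (<-≤-trans d<p (+-monoˡ-≤ t (offset-last t+u≤s*t)))
  ... | m , a , m≤s , a<t , offset-m+a≡d =
    fromℕ< (s≤s m≤s) , fromℕ< a<t ,
    trans (cong₂ (λ m a → offset m + a) (toℕ-fromℕ< (s≤s m≤s)) (toℕ-fromℕ< a<t)) offset-m+a≡d

module Construction (s u q k : ℕ) (n≤k : suc s + u + suc s + q ≤ k) where

  open Offsets s u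

  p n : ℕ
  p = t + u + t
  n = p + q

  open Residues n

  -- Window positions and offset sums stay below n, so they never wrap around.
  t≤n : t ≤ n
  t≤n = ≤-trans (m≤n+m t (t + u)) (m≤m+n p q)

  offset+a<n : (m a : Fin t) → offset (toℕ m) + toℕ a < n
  offset+a<n m a = <-≤-trans (compose-< m a) (m≤m+n p q)

  residue : ℕ → Fin k
  residue x = fromℕ< (<-≤-trans (m%n<n x n) n≤k)

  residue-≡⇔≈ : ∀ x y → residue x ≡ residue y ⇔ x ≈ y
  residue-≡⇔≈ x y = mk⇔ (fromℕ<-injective (x % n) (y % n) _ _)
                        (λ x≈y → fromℕ<-cong (x % n) (y % n) x≈y _ _)

  rowPoint columnPoint : Fin n → Fin t → Fin k
  rowPoint    i a = residue (toℕ i ⊖ toℕ a)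
  columnPoint j m = residue (toℕ j + offset (toℕ m))

  F G : Fin n → Subset k
  F i = image (rowPoint i)
  G j = image (columnPoint j)

  rowPoint-injective : ∀ i → Injective _≡_ _≡_ (rowPoint i)
  rowPoint-injective i {a} {a'} same-point = toℕ-injective
    (⊖-injective (<-≤-trans (toℕ<n a) t≤n) (<-≤-trans (toℕ<n a') t≤n)
                 (Equivalence.to (residue-≡⇔≈ (toℕ i ⊖ toℕ a) (toℕ i ⊖ toℕ a')) same-point))

  columnPoint-injective : ∀ j → Injective _≡_ _≡_ (columnPoint j)
  columnPoint-injective j {m} {m'} same-point = toℕ-injective
    (step-increasing⇒injective offset offset-increasing
      (≈⇒≡ (offset<n m) (offset<n m')
           (≈-cancelˡ (toℕ j) (Equivalence.to (residue-≡⇔≈ (toℕ j + offset (toℕ m))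
                                                          (toℕ j + offset (toℕ m'))) same-point))))
    where
    offset<n : (m : Fin t) → offset (toℕ m) < n
    offset<n m = ≤-<-trans (m≤m+n (offset (toℕ m)) 0) (offset+a<n m zero)

  collision⇔ : ∀ i j a m →
               rowPoint i a ≡ columnPoint j m ⇔ (toℕ i ⊖ toℕ j) % n ≡ offset (toℕ m) + toℕ a
  collision⇔ i j a m = ⇔-trans (residue-≡⇔≈ (toℕ i ⊖ toℕ a) (toℕ j + offset (toℕ m)))
    (meet-iff (<⇒≤ (toℕ<n j)) (≤-trans (<⇒≤ (toℕ<n a)) t≤n) (offset+a<n m a))

  meet⇔window : t + u ≤ s * t → ∀ i j → Nonempty (F i ∩ G j) ⇔ InWindow p i j
  meet⇔window t+u≤s*t i j = mk⇔ meet⇒window window⇒meet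
    where
    meet⇒window : Nonempty (F i ∩ G j) → InWindow p i j
    meet⇒window meet with Equivalence.to (image-meet (rowPoint i) (columnPoint j)) meet
    ... | a , m , collision =
      subst (_< p) (sym (Equivalence.to (collision⇔ i j a m) collision)) (compose-< m a)
    window⇒meet : InWindow p i j → Nonempty (F i ∩ G j)
    window⇒meet ij∈window with decompose t+u≤s*t ij∈window
    ... | m , a , offset+a≡d = Equivalence.from (image-meet (rowPoint i) (columnPoint j))
      (a , m , Equivalence.from (collision⇔ i j a m) (sym offset+a≡d))

  -- Rows and columns are distinct because those of the circulant are (q > 0).
  submatrix : t + u ≤ s * t → 0 < q → IsSubmatrixOfA k t (C p q)
  submatrix t+u≤s*t 0<q =
    F , G , F-injective , G-injective ,
    (λ i → ∣image∣ (rowPoint i) (rowPoint-injective i)) ,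
    (λ j → ∣image∣ (columnPoint j) (columnPoint-injective j)) ,
    (λ i j → ⇔-sym (meet⇔window t+u≤s*t i j))
    where
    0<p : 0 < p
    0<p = <-≤-trans (s≤s z≤n) (m≤n+m t (t + u))
    p<n : p < n
    p<n = subst (_≤ n) (+-comm p 1) (+-monoʳ-≤ p 0<q)
    F-injective : Injective _≡_ _≡_ F
    F-injective {i} {i'} Fi≡Fi' = row-determines 0<p p<n λ j →
      ⇔-trans (⇔-sym (meet⇔window t+u≤s*t i j))
              (subst (λ S → Nonempty (S ∩ G j) ⇔ InWindow p i' j) (sym Fi≡Fi')
                     (meet⇔window t+u≤s*t i' j))
    G-injective : Injective _≡_ _≡_ G
    G-injective {j} {j'} Gj≡Gj' = column-determines 0<p p<n λ i →
      ⇔-trans (⇔-sym (meet⇔window t+u≤s*t i j))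
              (subst (λ S → Nonempty (F i ∩ S) ⇔ InWindow p i j') (sym Gj≡Gj')
                     (meet⇔window t+u≤s*t i j'))

slack : ∀ {t p} → 2 * t ≤ p → ∃ λ u → t + u + t ≡ p
slack {t} 2t≤p with m≤n⇒∃[o]m+o≡n 2t≤p
... | u , 2t+u≡p = u , trans (rearrange t u) 2t+u≡p
  where
  rearrange : ∀ t u → t + u + t ≡ 2 * t + u
  rearrange = solve-∀

below-square : ∀ s u → suc s + u + suc s ≤ suc s * suc s → suc s + u ≤ s * suc s
below-square s u p≤t² = +-cancelˡ-≤ (suc s) (suc s + u) (s * suc s)
  (subst (_≤ suc s * suc s) (+-comm (suc s + u) (suc s)) p≤t²)

theorem3 : (t p q k : ℕ) → 0 < t → 0 < q → 2 * t ≤ p → p ≤ t * t → k ≥ p + q →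
    .{{_ : NonZero (p + q)}} → IsSubmatrixOfA k t (C p q)
theorem3 (suc s) p q k _ 0<q 2t≤p p≤t² n≤k with slack {suc s} 2t≤p
... | u , refl = Construction.submatrix s u q k n≤k (below-square s u p≤t²) 0<q
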